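{- With $z_2^*$ and $z_3^*$ defined as below, there exist instances of the Bin Packing with Usage Cost problem such that $z_2^*>z_3^*$. Here an instance has $m$ bins, bin $j$ having positive integer capacity $C_j$, fixed cost $f_j\ge 0$ and unit cost $c_j\ge 0$, $C_{max}=\max_j C_j$, and items whose distinct sizes are the positive integers $w'_1,\dots,w'_{n'}$ with $q_d$ items of size $w'_d$. $z_2^*$ is the optimal value of the linear relaxation (replacing $p_{ij}\in\{0,1\}$ by $p_{ij}\ge 0$) of $$\min \sum_{j=1}^m\sum_{i\in I_j} co_{ij}p_{ij}\quad\text{s.t.}\quad \sum_{j}\sum_{i\in I_j} g_{dij}p_{ij}=q_d\ \forall d,\qquad \sum_{i\in I_j}p_{ij}=1\ \forall j,\qquad p_{ij}\in\{0,1\},$$ where $I_j$ indexes all integer vectors $(g_{1ij},\dots,g_{n'ij})$ with $0\le g_{dij}\le q_d$ and $\sum_d g_{dij}w'_d\le C_j$, with $co_{ij}=f_j+c_j\sum_d g_{dij}w'_d$ for non-empty patterns and $co_{ij}=0$ for the empty pattern. $z_3^*$ is the optimal value of the linear relaxation (replacing $x_{ab}\in\mathbb{N}$ by $x_{ab}\ge0$ and $y_{aj}\in\{0,1\}$ by $0\le y_{aj}\le1$) of the arc-flow model on arc set $I=\{(a,a+w'_d): d\in\{1,\dots,n'\},\ a\ge0,\ a+w'_d\le C_{max}\}$ with variables $x_{ab}$, $(a,b)\in I$, and $y_{aj}$, $j\in\{1,\dots,m\}$, $a\in\{0,\dots,C_{max}\}$: $$\min \sum_{j=1}^m\sum_{a=0}^{C_{max}}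 co_{aj}y_{aj},\quad co_{aj}=f_j+ac_j\ (a>0),\ co_{0j}=0,$$ subject to $\sum_{(a,b)\in I}x_{ab}-\sum_{(b,c)\in I}x_{bc}-\sum_j y_{bj}=0$ for $b\in\{1,\dots,C_{max}\}$; $-\sum_{(0,c)\in I}x_{0c}-\sum_j y_{0j}=-m$; $\sum_{a=0}^{C_j}y_{aj}=1$ for all $j$; $\sum_{(a,a+w'_d)\in I}x_{a,a+w'_d}=q_d$ for all $d$; $y_{aj}=0$ for $a\in\{C_j+1,\dots,C_{max}\}$; $x_{ab}\in\mathbb{N}$; $y_{aj}\in\{0,1\}$.
   Context: The Bin Packing with Usage Cost problem: each item must be assigned to exactly one bin without exceeding capacities; a used bin $j$ with load $l_j$ costs $f_j+c_jl_j$, unused bins cost nothing; minimise total cost. The first model is a cutting-stock (pattern) formulation; the second is an arc-flow formulation in which arc $(a,a+w'_d)$ represents placing an item of size $w'_d$ and $y_{aj}$ represents bin $j$ being used up to load $a$.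
   Formalization: The fixed costs $f_j$, the unit costs $c_j$ and the variables of both linear relaxations take values in the rationals. -}

module Defs where

open import Data.Nat as ℕ using (ℕ; zero; suc; _⊔_; _≤?_)
open import Data.Nat.Properties using (_≟_)
open import Data.Integer using (+_)
open import Data.Rational using (ℚ; 0ℚ; 1ℚ; _+_; _*_; _-_; -_; _≤_; _<_; _/_)
open import Data.Fin using (Fin; zero; suc)
open import Data.Fin.Properties using (all?)
open import Data.List using (List; []; _∷_; map; concatMap; filter; foldr; upTo; allFin)
open import Data.Vec.Functional using () renaming (_∷_ to _∷ᶠ_)
open import Data.Product using (Σ; _×_; _,_; proj₁; proj₂; ∃)
open import Data.Bool using (if_then_else_)
open import Relation.Nullary using (does)
open import Relation.Binary.PropositionalEquality using (_≡_)
open import Function using (_∘_)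

⟦_⟧ : ℕ → ℚ
⟦ n ⟧ = + n / 1

sumℚ : List ℚ → ℚ
sumℚ = foldr _+_ 0ℚ

ΣFinℕ : (n : ℕ) → (Fin n → ℕ) → ℕ
ΣFinℕ zero    g = 0
ΣFinℕ (suc n) g = g zero ℕ.+ ΣFinℕ n (g ∘ suc)

ΣFinℚ : (n : ℕ) → (Fin n → ℚ) → ℚ
ΣFinℚ zero    g = 0ℚ
ΣFinℚ (suc n) g = g zero + ΣFinℚ n (g ∘ suc)

Σ≤ : ℕ → (ℕ → ℚ) → ℚ
Σ≤ n g = sumℚ (map g (upTo (suc n)))

maxFin : (m : ℕ) → (Fin m → ℕ) → ℕ
maxFin zero    C = 0
maxFin (suc m) C = C zero ⊔ maxFin m (C ∘ suc)

record Instance : Set where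
  field
    m    : ℕ
    C    : Fin m → ℕ
    f    : Fin m → ℚ
    c    : Fin m → ℚ
    n'   : ℕ
    w    : Fin n' → ℕ
    q    : Fin n' → ℕ
    C-pos : ∀ j → 0 ℕ.< C j
    f-nonneg : ∀ j → 0ℚ ≤ f j
    c-nonneg : ∀ j → 0ℚ ≤ c j
    w-pos : ∀ d → 0 ℕ.< w d
    w-distinct : ∀ d d' → w d ≡ w d' → d ≡ d'
    q-pos : ∀ d → 0 ℕ.< q d

boxes : (n : ℕ) → (Fin n → ℕ) → List (Fin n → ℕ)
boxes zero    q = (λ ()) ∷ []
boxes (suc n) q =
  concatMap (λ k → map (λ g → k ∷ᶠ g) (boxes n (q ∘ suc))) (upTo (suc (q zero)))

IsOptimalValue : {S : Set} → (S → Set) → (S → ℚ) → ℚ → Set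
IsOptimalValue {S} Feasible obj z =
  (Σ S λ s → Feasible s × obj s ≡ z) × (∀ s → Feasible s → z ≤ obj s)

module _ (I : Instance) where
  open Instance I

  Pattern : Set
  Pattern = Fin n' → ℕ

  load : Pattern → ℕ
  load g = ΣFinℕ n' (λ d → g d ℕ.* w d)

  patterns : Fin m → List Pattern
  patterns j = filter (λ g → load g ≤? C j) (boxes n' q)

  coP : Fin m → Pattern → ℚ
  coP j g = if does (all? (λ d → g d ≟ 0)) then 0ℚ else (f j + c j * ⟦ load g ⟧)

  -- variables p_ij of the pattern model (only values on patterns of I_j matter)
  PVars : Set
  PVars = Fin m → Pattern → ℚ

  ΣPat : Fin m → (Pattern → ℚ) → ℚ
  ΣPat j h = sumℚ (map h (patterns j))

  data _∈P_ (g : Pattern) : List Pattern → Set where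
    here  : ∀ {xs} → g ∈P (g ∷ xs)
    there : ∀ {h xs} → g ∈P xs → g ∈P (h ∷ xs)

  FeasibleLP2 : PVars → Set
  FeasibleLP2 p =
    (∀ d → ΣFinℚ m (λ j → ΣPat j (λ g → ⟦ g d ⟧ * p j g)) ≡ ⟦ q d ⟧) ×
    (∀ j → ΣPat j (λ g → p j g) ≡ 1ℚ) ×
    (∀ j g → g ∈P patterns j → 0ℚ ≤ p j g)

  objLP2 : PVars → ℚ
  objLP2 p = ΣFinℚ m (λ j → ΣPat j (λ g → coP j g * p j g))

  z2* : ℚ → Set
  z2* = IsOptimalValue FeasibleLP2 objLP2

  Cmax : ℕ
  Cmax = maxFin m C

  arcsOf : Fin n' → List (ℕ × ℕ)
  arcsOf d = map (λ a → (a , a ℕ.+ w d))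
               (filter (λ a → a ℕ.+ w d ≤? Cmax) (upTo (suc Cmax)))

  arcs : List (ℕ × ℕ)
  arcs = concatMap arcsOf (allFin n')

  AVars : Set
  AVars = (ℕ → ℕ → ℚ) × (ℕ → Fin m → ℚ)

  sumArcs : List (ℕ × ℕ) → (ℕ → ℕ → ℚ) → ℚ
  sumArcs A x = sumℚ (map (λ ab → x (proj₁ ab) (proj₂ ab)) A)

  into outof : ℕ → List (ℕ × ℕ)
  into b  = filter (λ ab → proj₂ ab ≟ b) arcs
  outof b = filter (λ ab → proj₁ ab ≟ b) arcs

  coA : ℕ → Fin m → ℚ
  coA zero    j = 0ℚ
  coA (suc a) j = f j + ⟦ suc a ⟧ * c j

  data _∈A_ (e : ℕ × ℕ) : List (ℕ × ℕ) → Set where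
    here  : ∀ {xs} → e ∈A (e ∷ xs)
    there : ∀ {h xs} → e ∈A xs → e ∈A (h ∷ xs)

  FeasibleLP3 : AVars → Set
  FeasibleLP3 (x , y) =
    (∀ b → 1 ℕ.≤ b → b ℕ.≤ Cmax →
       (sumArcs (into b) x - sumArcs (outof b) x) - ΣFinℚ m (λ j → y b j) ≡ 0ℚ) ×
    ((- sumArcs (outof 0) x) - ΣFinℚ m (λ j → y 0 j) ≡ - ⟦ m ⟧) ×
    (∀ j → Σ≤ (C j) (λ a → y a j) ≡ 1ℚ) ×
    (∀ d → sumArcs (arcsOf d) x ≡ ⟦ q d ⟧) ×
    (∀ j a → C j ℕ.< a → a ℕ.≤ Cmax → y a j ≡ 0ℚ) ×
    (∀ a b → (a , b) ∈A arcs → 0ℚ ≤ x a b) ×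
    (∀ a j → a ℕ.≤ Cmax → (0ℚ ≤ y a j × y a j ≤ 1ℚ))

  objLP3 : AVars → ℚ
  objLP3 (x , y) = ΣFinℚ m (λ j → Σ≤ Cmax (λ a → coA a j * y a j))

  z3* : ℚ → Set
  z3* = IsOptimalValue FeasibleLP3 objLP3

module Submission where

-- The two linear relaxations differ already on the smallest interesting
-- instance: one bin of capacity 2 with fixed cost 1 and unit cost 0, and a
-- single item of size 1.
--
-- * Pattern model.  The only patterns are "empty" and "the item".  The
--   demand row says the item-pattern has weight 1, and since it is the only
--   pattern of positive cost (cost 1) the objective coincides with the
--   left-hand side of the demand row; hence every feasible point costs
--   exactly 1 and z₂* = 1.
-- * Arc-flow model.  The arcs are 0→1 and 1→2.  Sending half a unit along the
--   path 0→1→2 and letting the bin stop at loads 0 and 2 with weight ½ each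
--   satisfies every constraint at cost ½.  Conversely, on any feasible point
--   the objective equals ½ + ½·y₁ plus a linear combination of the flow
--   conservation rows at 1 and 2 and the demand row (a dual certificate);
--   those rows vanish and y₁ ≥ 0, so z₃* = ½.

open import Defs
open import Data.Rational using (ℚ; _<_)
open import Data.Product using (Σ; _×_)

open import Data.Nat using (ℕ; suc; s≤s; z≤n)
open import Data.Nat.Properties using (<⇒≱)
open import Data.Rational using (0ℚ; 1ℚ; ½; _+_; _*_; _-_; -_; _≤_)
open import Data.Rational.Properties using (_≤?_; _<?_; ≤-reflexive; ≤-trans; +-monoʳ-≤; +-identityʳ; *-monoˡ-≤-nonNeg)
open import Data.Rational.Solver using (module +-*-Solver)
open import Data.Fin using (Fin)
open import Data.Empty using (⊥-elim)
open import Data.Product using (_,_; proj₁)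
open import Relation.Nullary.Decidable using (True; toWitness)
open import Relation.Binary.PropositionalEquality using (_≡_; refl; sym; trans; cong; cong₂; module ≡-Reasoning)

≤-by-evaluation : ∀ p q → {True (p ≤? q)} → p ≤ q
≤-by-evaluation p q {p≤q} = toWitness p≤q

<-by-evaluation : ∀ p q → {True (p <? q)} → p < q
<-by-evaluation p q {p<q} = toWitness p<q

-- Adding a non-negative slack can only increase a value; this turns the
-- dual certificate below into a lower bound.
≤-plus-slack : ∀ v s → 0ℚ ≤ s → v ≤ v + s
≤-plus-slack v s 0≤s = ≤-trans (≤-reflexive (sym (+-identityʳ v))) (+-monoʳ-≤ v 0≤s)

oneItemOneBin : Instance
oneItemOneBin = record
  { m = 1 ; C = λ _ → 2 ; f = λ _ → 1ℚ ; c = λ _ → 0ℚ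
  ; n' = 1 ; w = λ _ → 1 ; q = λ _ → 1
  ; C-pos = λ _ → s≤s z≤n
  ; f-nonneg = λ _ → ≤-by-evaluation 0ℚ 1ℚ
  ; c-nonneg = λ _ → ≤-by-evaluation 0ℚ 0ℚ
  ; w-pos = λ _ → s≤s z≤n
  ; w-distinct = λ { Fin.zero Fin.zero _ → refl }
  ; q-pos = λ _ → s≤s z≤n
  }

open Instance oneItemOneBin using (m)

demandRow : PVars oneItemOneBin → ℚ
demandRow p = ΣFinℚ m (λ j → ΣPat oneItemOneBin j (λ g → ⟦ g Fin.zero ⟧ * p j g))

-- The patterns are g = 0 (cost 0) and g = 1 (cost 1), so the objective of
-- the pattern model is literally the demand row.
objLP2≡demandRow : ∀ p → objLP2 oneItemOneBin p ≡ demandRow p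
objLP2≡demandRow p = refl

-- Weighting each pattern by its own multiplicity puts weight 1 on the
-- item-pattern and 0 on the empty one.
itemPattern : PVars oneItemOneBin
itemPattern _ g = ⟦ g Fin.zero ⟧

itemPattern-feasible : FeasibleLP2 oneItemOneBin itemPattern
itemPattern-feasible =
    (λ { Fin.zero → refl })
  , (λ { Fin.zero → refl })
  , λ { Fin.zero g here               → ≤-by-evaluation 0ℚ 0ℚ
      ; Fin.zero g (there here)       → ≤-by-evaluation 0ℚ 1ℚ
      ; Fin.zero g (there (there ())) }

z₂*≡1 : z2* oneItemOneBin 1ℚ
z₂*≡1 = (itemPattern , itemPattern-feasible , refl)
      , λ p (demand , _) → ≤-reflexive (sym (trans (objLP2≡demandRow p) (demand Fin.zero)))

halfLoad : ℕ → Fin m → ℚ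
halfLoad 0 _ = ½
halfLoad 2 _ = ½
halfLoad _ _ = 0ℚ

halfFlow : AVars oneItemOneBin
halfFlow = (λ _ _ → ½) , halfLoad

halfFlow-feasible : FeasibleLP3 oneItemOneBin halfFlow
halfFlow-feasible =
    (λ { 1 _ _ → refl ; 2 _ _ → refl ; (suc (suc (suc _))) _ (s≤s (s≤s ())) })
  , refl
  , (λ { Fin.zero → refl })
  , (λ { Fin.zero → refl })
  , (λ _ a 2<a a≤2 → ⊥-elim (<⇒≱ 2<a a≤2))
  , (λ _ _ _ → ≤-by-evaluation 0ℚ ½)
  , λ { 0 Fin.zero _ → ≤-by-evaluation 0ℚ ½ , ≤-by-evaluation ½ 1ℚ
      ; 1 Fin.zero _ → ≤-by-evaluation 0ℚ 0ℚ , ≤-by-evaluation 0ℚ 1ℚ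
      ; 2 Fin.zero _ → ≤-by-evaluation 0ℚ ½ , ≤-by-evaluation ½ 1ℚ
      ; (suc (suc (suc _))) _ (s≤s (s≤s ())) }

record UsedConstraints (x₀₁ x₁₂ y₁ y₂ : ℚ) : Set where
  field
    flowAt1 : x₀₁ - x₁₂ - y₁ ≡ 0ℚ
    flowAt2 : x₁₂ - y₂ ≡ 0ℚ
    demand  : x₀₁ + x₁₂ ≡ 1ℚ
    y₁≥0    : 0ℚ ≤ y₁

open +-*-Solver

-- The sums over the (one- or two-element) arc lists end with "+ 0".
usedConstraints : ∀ x y → FeasibleLP3 oneItemOneBin (x , y) →
  UsedConstraints (x 0 1) (x 1 2) (y 1 Fin.zero) (y 2 Fin.zero)
usedConstraints x y (flow , _ , _ , demand , _ , _ , bounds) = record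
  { flowAt1 = trans (sym (dropZeros₃ (x 0 1) (x 1 2) (y 1 Fin.zero))) (flow 1 (s≤s z≤n) (s≤s z≤n))
  ; flowAt2 = trans (sym (dropZeros₂ (x 1 2) (y 2 Fin.zero))) (flow 2 (s≤s z≤n) (s≤s (s≤s z≤n)))
  ; demand  = trans (sym (cong (x 0 1 +_) (+-identityʳ (x 1 2)))) (demand Fin.zero)
  ; y₁≥0    = proj₁ (bounds 1 Fin.zero (s≤s z≤n))
  }
  where
  dropZeros₃ : ∀ a b c → ((a + 0ℚ) - (b + 0ℚ)) - (c + 0ℚ) ≡ a - b - c
  dropZeros₃ = solve 3 (λ a b c → ((a :+ con 0ℚ) :- (b :+ con 0ℚ)) :- (c :+ con 0ℚ) := a :- b :- c) refl
  dropZeros₂ : ∀ a b → ((a + 0ℚ) - 0ℚ) - (b + 0ℚ) ≡ a - b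
  dropZeros₂ = solve 2 (λ a b → ((a :+ con 0ℚ) :- con 0ℚ) :- (b :+ con 0ℚ) := a :- b) refl

-- Load 0 is free and loads 1 and 2 both cost f = 1.
objLP3≡y₁+y₂ : ∀ x y → objLP3 oneItemOneBin (x , y) ≡ y 1 Fin.zero + y 2 Fin.zero
objLP3≡y₁+y₂ x y = objective (y 0 Fin.zero) (y 1 Fin.zero) (y 2 Fin.zero)
  where
  objective : ∀ y₀ y₁ y₂ → (0ℚ * y₀ + (1ℚ * y₁ + (1ℚ * y₂ + 0ℚ))) + 0ℚ ≡ y₁ + y₂
  objective = solve 3 (λ y₀ y₁ y₂ →
    (con 0ℚ :* y₀ :+ (con 1ℚ :* y₁ :+ (con 1ℚ :* y₂ :+ con 0ℚ))) :+ con 0ℚ := y₁ :+ y₂) refl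

dualCertificate : ∀ x₀₁ x₁₂ y₁ y₂ →
  y₁ + y₂ ≡ (½ + ½ * y₁) + ((- ½) * (x₀₁ - x₁₂ - y₁) + (- 1ℚ) * (x₁₂ - y₂) + ½ * (x₀₁ + x₁₂ - 1ℚ))
dualCertificate = solve 4 (λ x₀₁ x₁₂ y₁ y₂ →
  y₁ :+ y₂ := (con ½ :+ con ½ :* y₁)
              :+ (con (- ½) :* (x₀₁ :- x₁₂ :- y₁) :+ con (- 1ℚ) :* (x₁₂ :- y₂)
                  :+ con ½ :* (x₀₁ :+ x₁₂ :- con 1ℚ))) refl

arcFlow-lowerBound : ∀ s → FeasibleLP3 oneItemOneBin s → ½ ≤ objLP3 oneItemOneBin s
arcFlow-lowerBound (x , y) feasible =
  ≤-trans (≤-plus-slack ½ (½ * y₁) (*-monoˡ-≤-nonNeg ½ y₁≥0)) (≤-reflexive (sym objective≡))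
  where
  open UsedConstraints (usedConstraints x y feasible)
  y₁ = y 1 Fin.zero
  open ≡-Reasoning
  objective≡ : objLP3 oneItemOneBin (x , y) ≡ ½ + ½ * y₁
  objective≡ = begin
    objLP3 oneItemOneBin (x , y)
      ≡⟨ objLP3≡y₁+y₂ x y ⟩
    y₁ + y 2 Fin.zero
      ≡⟨ dualCertificate (x 0 1) (x 1 2) y₁ (y 2 Fin.zero) ⟩
    (½ + ½ * y₁) + ((- ½) * (x 0 1 - x 1 2 - y₁) + (- 1ℚ) * (x 1 2 - y 2 Fin.zero) + ½ * (x 0 1 + x 1 2 - 1ℚ))
      ≡⟨ cong (λ r → (½ + ½ * y₁) + r)
              (cong₂ _+_ (cong₂ _+_ (cong ((- ½) *_) flowAt1) (cong ((- 1ℚ) *_) flowAt2))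
                         (cong (λ t → ½ * (t - 1ℚ)) demand)) ⟩
    (½ + ½ * y₁) + 0ℚ
      ≡⟨ +-identityʳ (½ + ½ * y₁) ⟩
    ½ + ½ * y₁ ∎

z₃*≡½ : z3* oneItemOneBin ½
z₃*≡½ = (halfFlow , halfFlow-feasible , refl) , arcFlow-lowerBound

proposition4 : Σ Instance λ I → Σ ℚ λ v2 → Σ ℚ λ v3 →
    z2* I v2 × z3* I v3 × v3 < v2
proposition4 = oneItemOneBin , 1ℚ , ½ , z₂*≡1 , z₃*≡½ , <-by-evaluation ½ 1ℚ
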